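{- Let $p$ be a prime number and $w$ a nonempty word over $[\![p]\!]$. For any words $a,b$ over $[\![p]\!]$ and any positive integer $\ell$, there exists a word $u$ over $[\![p]\!]$ with $|u|=\ell$ such that $|au|_w=|a|_w$ and $|bu|_w=|b|_w$.
   Context: $[\![p]\!]=\{0,\dots,p-1\}$. For words $x,w$, $|x|_w$ denotes the number of occurrences of $w$ as a factor (contiguous block, counted at every starting position) of $x$; $au$ denotes concatenation. -}

module Defs where

open import Data.Nat using (ℕ; zero; suc)
open import Data.Fin using (Fin)
open import Data.Fin.Properties using () renaming (_≟_ to _≟F_)
open import Data.List using (List; []; _∷_)
open import Data.Bool using (Bool; true; false; if_then_else_; _∧_)
open import Relation.Nullary.Decidable using (⌊_⌋)

Word : ℕ → Set
Word p = List (Fin p)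

isPrefix : {p : ℕ} → Word p → Word p → Bool
isPrefix []      _        = true
isPrefix (_ ∷ _) []       = false
isPrefix (c ∷ w) (d ∷ x)  = ⌊ c ≟F d ⌋ ∧ isPrefix w x

occ : {p : ℕ} → Word p → Word p → ℕ
occ [] w = if isPrefix w [] then 1 else 0
occ (c ∷ x) w = (if isPrefix w (c ∷ x) then 1 else 0) Data.Nat.+ occ x w

-- Pad with a letter d different from the last letter of w (one exists because p ≥ 2).
-- An occurrence of w ending inside the padding would end in d, so appending any
-- number of d's creates no new occurrence, whatever the prefix; take u = d^ℓ
-- (this works for ℓ = 0 as well).
module Submission where

open import Defs
open import Data.Nat using (ℕ; _≤_; zero; suc; _+_)
open import Data.Nat.Primality using (Prime; ¬prime[1])
open import Data.List using (List; []; _∷_; _++_; length; replicate)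
open import Data.List.Properties using (length-replicate)
open import Data.Product using (∃; _×_; _,_; map₂)
open import Data.Fin using (Fin; punchIn)
import Data.Fin as Fin
open import Data.Fin.Properties using (punchInᵢ≢i) renaming (_≟_ to _≟F_)
open import Data.Bool using (Bool; true; false; _∧_; if_then_else_)
open import Data.Bool.Properties using (∧-zeroʳ)
open import Data.Empty using (⊥-elim)
open import Function using (_∘_)
open import Relation.Nullary.Decidable using (isYes≗does; dec-false)
open import Relation.Binary.PropositionalEquality using (_≡_; _≢_; refl; sym; trans; cong; cong₂)

data Last {A : Set} (P : A → Set) : List A → Set where
  [_] : ∀ {x} → P x → Last P (x ∷ [])
  _∷_ : ∀ x {xs} → Last P xs → Last P (x ∷ xs)

otherLetter : ∀ {p} → Prime p → (e : Fin p) → ∃ λ d → e ≢ d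
otherLetter {suc zero} pr _ = ⊥-elim (¬prime[1] pr)
otherLetter {suc (suc _)} _ e = punchIn e Fin.zero , punchInᵢ≢i e Fin.zero ∘ sym

lastAvoidingLetter : ∀ {p} → Prime p → (w : Word p) → w ≢ [] → ∃ λ d → Last (_≢ d) w
lastAvoidingLetter pr [] w≢[] = ⊥-elim (w≢[] refl)
lastAvoidingLetter pr (e ∷ []) _ = map₂ [_] (otherLetter pr e)
lastAvoidingLetter pr (c ∷ w@(_ ∷ _)) _ = map₂ (c ∷_) (lastAvoidingLetter pr w λ ())

indicator : Bool → ℕ
indicator b = if b then 1 else 0

module _ {p : ℕ} {d : Fin p} where

  isPrefix-[] : ∀ {w} → Last (_≢ d) w → isPrefix w [] ≡ false
  isPrefix-[] [ _ ] = refl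
  isPrefix-[] (_ ∷ _) = refl

  isPrefix-++-replicate : ∀ {w} → Last (_≢ d) w → (x : Word p) (n : ℕ) →
                          isPrefix w (x ++ replicate n d) ≡ isPrefix w x
  isPrefix-++-replicate [ _ ] [] zero = refl
  isPrefix-++-replicate [ e≢d ] [] (suc n) =
    cong (_∧ true) (trans (isYes≗does (_ ≟F d)) (dec-false (_ ≟F d) e≢d))
  isPrefix-++-replicate [ _ ] (_ ∷ _) n = refl
  isPrefix-++-replicate (_ ∷ _) [] zero = refl
  isPrefix-++-replicate (_ ∷ l) [] (suc n) =
    trans (cong (_ ∧_) (trans (isPrefix-++-replicate l [] n) (isPrefix-[] l))) (∧-zeroʳ _)
  isPrefix-++-replicate (_ ∷ l) (_ ∷ x) n = cong (_ ∧_) (isPrefix-++-replicate l x n)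

  occ-++-replicate : ∀ {w} → Last (_≢ d) w → (x : Word p) (n : ℕ) →
                     occ (x ++ replicate n d) w ≡ occ x w
  occ-++-replicate l [] zero = refl
  occ-++-replicate l [] (suc n) =
    cong₂ _+_ (cong indicator (trans (isPrefix-++-replicate l [] (suc n)) (isPrefix-[] l)))
              (occ-++-replicate l [] n)
  occ-++-replicate l x@(_ ∷ x′) n =
    cong₂ _+_ (cong indicator (isPrefix-++-replicate l x n))
              (occ-++-replicate l x′ n)

lemma11 : (p : ℕ) → Prime p → (w : Word p) → w ≢ [] → (a b : Word p) → (ℓ : ℕ) → 1 ≤ ℓ →
    ∃ λ (u : Word p) → (length u ≡ ℓ) × (occ (a ++ u) w ≡ occ a w) × (occ (b ++ u) w ≡ occ b w)
lemma11 p pr w w≢[] a b ℓ _ with lastAvoidingLetter pr w w≢[]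
... | d , l = replicate ℓ d , length-replicate ℓ , occ-++-replicate l a ℓ , occ-++-replicate l b ℓ
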